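{- Let $A,B,C$ be finite sets, let $\varphi(x,y)$ be a condensation formula over $A$, and let $f:A^{\mathrm{ord}+}\to B$ and $g:B^{\mathrm{ord}}\to C$ be FO-definable functions. Then the map $A^{\mathrm{ord}}\to C$, $$u\mapsto g\Big(\prod_{i\in\mathrm{dom}(\hat\varphi(u))}f(\hat\varphi(u)_i)\Big),$$ (where the product denotes the word over $B$ indexed by $\mathrm{dom}(\hat\varphi(u))$ whose $i$-th letter is $f(\hat\varphi(u)_i)$) is FO-definable.
   Context: A countable ordinal word over $X$ is a map from a countable ordinal (its domain) to $X$; $X^{\mathrm{ord}}$ is the set of them and $X^{\mathrm{ord}+}$ the nonempty ones. First-order logic over alphabet $A$: atoms $x<y$ and $a(x)$ interpreted on positions. A language is FO-definable if it is the set of models of a first-order sentence; a function $f:L\to X$ into a finite set $X$ is FO-definable if every preimage $f^{ -1}[x]$ is an FO-definable language. A condensation of an ordinal $\alpha$ is an equivalence relation on $\alpha$ with convex classes (the quotient is again an ordinal). A condensation formula is a first-order formula $\varphi(x,y)$ such that for every $w\in A^{\mathrm{ord}}$ the relation $\iota\sim\kappa$ iff $w,[x\mapsto\iota,y\mapsto\kappa]\models\varphi$ is a condensation of $\mathrm{dom}(w)$. It induces $\hat\varphi:A^{\mathrm{ord}}\to(A^{\mathrm{ord}+})^{\mathrm{ord}}$, where $\hat\varphi(u)$ has domain $\mathrm{dom}(u)/\sim$ and its $I$-th letter is the subword $(u_\iota)_{\iota\in I}$. -}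

module Defs where

open import Level using (Level; _⊔_) renaming (suc to lsuc; zero to 0ℓ)
open import Data.Nat using (ℕ; zero; suc; _≤_)
open import Data.Fin using (Fin; zero; suc)
open import Data.Product using (Σ; ∃; _×_; _,_; proj₁)
open import Data.Sum using (_⊎_)
open import Data.Empty using (⊥)
open import Relation.Nullary using (¬_)
open import Relation.Binary.PropositionalEquality using (_≡_)
open import Induction.WellFounded using (WellFounded)
open import Function.Bundles using (_↔_; _⇔_)

Finite : ∀ {a} → Set a → Set a
Finite A = Σ ℕ λ k → A ↔ Fin k

-- Positions are natural numbers;
-- the domain is the subset `dom` of ℕ, ordered by `lt`; `lab` gives the letter
-- at each position (values outside `dom` are irrelevant).
record Word {a : Level} (X : Set a) : Set (lsuc 0ℓ ⊔ a) where
  field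
    dom : ℕ → Set
    lt  : ℕ → ℕ → Set
    lab : ℕ → X
open Word public

-- `lt` restricted to `dom` is a well-order (so dom, ordered by lt, is a
-- countable ordinal; every countable ordinal arises this way).
record IsOrdinalWord {a} {X : Set a} (w : Word X) : Set₁ where
  field
    irrefl : ∀ n → dom w n → ¬ lt w n n
    trans  : ∀ m n k → dom w m → dom w n → dom w k →
             lt w m n → lt w n k → lt w m k
    tri    : ∀ m n → dom w m → dom w n → lt w m n ⊎ (m ≡ n ⊎ lt w n m)
    wf     : WellFounded (λ (x y : Σ ℕ (dom w)) → lt w (proj₁ x) (proj₁ y))

NonEmpty : ∀ {a} {X : Set a} → Word X → Set
NonEmpty w = ∃ λ n → dom w n

-- First-order formulas over alphabet A with n free variables (de Bruijn),
-- atoms x < y and a(x); connectives ¬, ∧, ∃ (the others are definable).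
data Formula (A : Set) : ℕ → Set where
  less  : ∀ {n} → Fin n → Fin n → Formula A n
  letter : ∀ {n} → A → Fin n → Formula A n
  neg   : ∀ {n} → Formula A n → Formula A n
  and   : ∀ {n} → Formula A n → Formula A n → Formula A n
  ex    : ∀ {n} → Formula A (suc n) → Formula A n

extend : ∀ {n} → ℕ → (Fin n → ℕ) → Fin (suc n) → ℕ
extend m env zero    = m
extend m env (suc i) = env i

Sat : ∀ {A n} → Word A → (Fin n → ℕ) → Formula A n → Set
Sat w env (less i j)   = lt w (env i) (env j)
Sat w env (letter a i) = lab w (env i) ≡ a
Sat w env (neg φ)      = ¬ Sat w env φ
Sat w env (and φ ψ)    = Sat w env φ × Sat w env ψ
Sat w env (ex φ)       = Σ ℕ λ m → dom w m × Sat w (extend m env) φ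

Sentence : Set → Set
Sentence A = Formula A 0

emptyEnv : Fin 0 → ℕ
emptyEnv ()

Models : ∀ {A} → Word A → Sentence A → Set
Models w ψ = Sat w emptyEnv ψ

env2 : ℕ → ℕ → Fin 2 → ℕ
env2 m n zero       = m
env2 m n (suc zero) = n

Rel : ∀ {A} → Formula A 2 → Word A → ℕ → ℕ → Set
Rel φ w m n = Sat w (env2 m n) φ

FODefinable : ∀ {A : Set} {X : Set} → (Word A → Set) → (Word A → X) → Set₁
FODefinable {A} {X} P f =
  ∀ (x : X) → Σ (Sentence A) λ ψ →
    ∀ (w : Word A) → IsOrdinalWord w → P w → (f w ≡ x ⇔ Models w ψ)

AllWords : ∀ {A : Set} → Word A → Set
AllWords _ = Data.Unit.⊤
  where import Data.Unit

IsCondensationFormula : ∀ {A} → Formula A 2 → Set₁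
IsCondensationFormula {A} φ =
  ∀ (w : Word A) → IsOrdinalWord w →
    (∀ m → dom w m → Rel φ w m m) ×
    (∀ m n → dom w m → dom w n → Rel φ w m n → Rel φ w n m) ×
    (∀ m n k → dom w m → dom w n → dom w k →
       Rel φ w m n → Rel φ w n k → Rel φ w m k) ×
    (∀ m n k → dom w m → dom w n → dom w k →
       lt w m n → lt w n k → Rel φ w m k → Rel φ w m n)

classWord : ∀ {A} → Formula A 2 → Word A → ℕ → Word A
classWord φ u n = record
  { dom = λ k → dom u k × Rel φ u k n
  ; lt  = lt u
  ; lab = lab u }

-- φ̂(u): the quotient dom(u)/∼ is represented by the ℕ-least element of each
-- class; ordered as in u; the letter at a class is the corresponding subword.
condense : ∀ {A} → Formula A 2 → Word A → Word (Word A)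
condense φ u = record
  { dom = λ n → dom u n × (∀ m → dom u m → Rel φ u m n → n ≤ m)
  ; lt  = lt u
  ; lab = classWord φ u }

mapWord : ∀ {a b} {X : Set a} {Y : Set b} → (X → Y) → Word X → Word Y
mapWord f v = record { dom = dom v ; lt = lt v ; lab = λ n → f (lab v n) }

-- The sentence defining g⁻¹[c] is interpreted in u: a position of φ̂(u) is
-- represented by the first position of its class (first in the order of u,
-- which is FO-definable from φ), quantifiers are relativised to such first
-- positions, and a letter b at a class is the sentence defining f⁻¹[b],
-- relativised to that class.  Because classes are convex, the order of u
-- between first positions of distinct classes is the order of φ̂(u).
module Submission where

open import Defs
open import Axiom.ExcludedMiddle using (ExcludedMiddle)
open import Level using (_⊔_) renaming (zero to 0ℓ)

open import Data.Nat using (ℕ; zero; suc; _≤_; _<_)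
open import Data.Nat.Properties using (≤-antisym; ≮⇒≥)
open import Data.Nat.Induction using (<-wellFounded)
open import Data.Fin using (Fin; zero; suc)
open import Data.Product using (Σ; _×_; _,_; proj₁; proj₂)
open import Data.Product.Function.NonDependent.Propositional using (_×-⇔_)
open import Data.Product.Function.Dependent.Propositional using (Σ-⇔)
open import Data.Sum using (inj₁; inj₂)
open import Data.Empty using (⊥-elim)
open import Data.Unit using (tt)
open import Relation.Nullary using (¬_; yes; no)
open import Relation.Binary using () renaming (Rel to BinRel)
open import Relation.Binary.PropositionalEquality
  using (_≡_; refl; sym; trans; cong; subst; subst₂)
open import Induction.WellFounded using (WellFounded; Acc; acc)
open import Function.Bundles using (_⇔_; mk⇔; Equivalence)
open import Function.Construct.Identity using (⇔-id; ↠-id)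
open import Function.Construct.Symmetry using (⇔-sym)
open import Function.Construct.Composition using (_⇔-∘_)
open import Function.Related.TypeIsomorphisms using (¬-cong-⇔)

open Equivalence using (to; from)

minimal-element : ∀ {a r ℓ} {X : Set a} {_≺_ : BinRel X r} {P : X → Set ℓ} →
  ExcludedMiddle (a ⊔ r ⊔ ℓ) → WellFounded _≺_ → ∀ {x} → P x →
  Σ X λ m → P m × (∀ {y} → y ≺ m → ¬ P y)
minimal-element {X = X} {_≺_} {P} em wf {x} = descend (wf x)
  where
  descend : ∀ {x} → Acc _≺_ x → P x → Σ X λ m → P m × (∀ {y} → y ≺ m → ¬ P y)
  descend {x} (acc rs) px with em {Σ X λ y → y ≺ x × P y}
  ... | yes (y , y≺x , py) = descend (rs y≺x) py
  ... | no nothing-below   = x , px , λ y≺x py → nothing-below (_ , y≺x , py)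

restrict-isOrdinalWord : ∀ {a b} {X : Set a} {Y : Set b} (w : Word X) →
  IsOrdinalWord w → (D : ℕ → Set) → (∀ n → D n → dom w n) → (l : ℕ → Y) →
  IsOrdinalWord (record { dom = D ; lt = lt w ; lab = l })
restrict-isOrdinalWord w ow D D⊆dom l = record
  { irrefl = λ n d → W.irrefl n (D⊆dom n d)
  ; trans  = λ m n k dm dn dk → W.trans m n k (D⊆dom m dm) (D⊆dom n dn) (D⊆dom k dk)
  ; tri    = λ m n dm dn → W.tri m n (D⊆dom m dm) (D⊆dom n dn)
  ; wf     = λ (x , d) → restrict-acc (W.wf (x , D⊆dom x d))
  }
  where
  module W = IsOrdinalWord ow
  restrict-acc : ∀ {x} {d : D x} →
    Acc (λ (p q : Σ ℕ (dom w)) → lt w (proj₁ p) (proj₁ q)) (x , D⊆dom x d) →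
    Acc (λ (p q : Σ ℕ D) → lt w (proj₁ p) (proj₁ q)) (x , d)
  restrict-acc (acc rs) = acc λ y<x → restrict-acc (rs y<x)

lift : ∀ {k m} → (Fin k → Fin m) → Fin (suc k) → Fin (suc m)
lift ρ zero    = zero
lift ρ (suc i) = suc (ρ i)

rename : ∀ {A k m} → (Fin k → Fin m) → Formula A k → Formula A m
rename ρ (less i j)   = less (ρ i) (ρ j)
rename ρ (letter a i) = letter a (ρ i)
rename ρ (neg ψ)      = neg (rename ρ ψ)
rename ρ (and ψ χ)    = and (rename ρ ψ) (rename ρ χ)
rename ρ (ex ψ)       = ex (rename (lift ρ) ψ)

extend-lift : ∀ {k m} (y : ℕ) (ρ : Fin k → Fin m) {e : Fin m → ℕ} {e′ : Fin k → ℕ} →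
  (∀ i → e (ρ i) ≡ e′ i) → ∀ i → extend y e (lift ρ i) ≡ extend y e′ i
extend-lift y ρ eq zero    = refl
extend-lift y ρ eq (suc i) = eq i

Sat-rename : ∀ {A k m} (w : Word A) (ρ : Fin k → Fin m) {e : Fin m → ℕ} {e′ : Fin k → ℕ} →
  (∀ i → e (ρ i) ≡ e′ i) → (ψ : Formula A k) → Sat w e (rename ρ ψ) ⇔ Sat w e′ ψ
Sat-rename w ρ eq (less i j) =
  mk⇔ (subst₂ (lt w) (eq i) (eq j)) (subst₂ (lt w) (sym (eq i)) (sym (eq j)))
Sat-rename w ρ eq (letter a i) =
  mk⇔ (trans (cong (lab w) (sym (eq i)))) (trans (cong (lab w) (eq i)))
Sat-rename w ρ eq (neg ψ)   = ¬-cong-⇔ (Sat-rename w ρ eq ψ)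
Sat-rename w ρ eq (and ψ χ) = Sat-rename w ρ eq ψ ×-⇔ Sat-rename w ρ eq χ
Sat-rename w ρ eq (ex ψ)    =
  Σ-⇔ (↠-id ℕ) λ {y} → ⇔-id _ ×-⇔ Sat-rename w (lift ρ) (extend-lift y ρ eq) ψ

module Condensation {A : Set} (φ : Formula A 2) where

  pairVar : ∀ {m} → Fin m → Fin m → Fin 2 → Fin m
  pairVar i j zero       = i
  pairVar i j (suc zero) = j

  sameClass : ∀ {m} → Fin m → Fin m → Formula A m
  sameClass i j = rename (pairVar i j) φ

  relativise : ∀ {k m} → (Fin k → Fin m) → Fin m → Formula A k → Formula A m
  relativise ρ g (less i j)   = less (ρ i) (ρ j)
  relativise ρ g (letter a i) = letter a (ρ i)
  relativise ρ g (neg ψ)      = neg (relativise ρ g ψ)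
  relativise ρ g (and ψ χ)    = and (relativise ρ g ψ) (relativise ρ g χ)
  relativise ρ g (ex ψ)       =
    ex (and (sameClass zero (suc g)) (relativise (lift ρ) (suc g) ψ))

  isFirst : ∀ {n} → Formula A (suc n)
  isFirst = neg (ex (and (less zero (suc zero)) (sameClass zero (suc zero))))

  translate : ∀ {B n} → (B → Sentence A) → Formula B n → Formula A n
  translate fs (less i j)   = less i j
  translate fs (letter b i) = relativise (λ ()) i (fs b)
  translate fs (neg ψ)      = neg (translate fs ψ)
  translate fs (and ψ χ)    = and (translate fs ψ) (translate fs χ)
  translate fs (ex ψ)       = ex (and isFirst (translate fs ψ))

  module _ (u : Word A) where

    private
      R : ℕ → ℕ → Set
      R = Rel φ u

    Sat-sameClass : ∀ {m} (e : Fin m → ℕ) (i j : Fin m) →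
      Sat u e (sameClass i j) ⇔ R (e i) (e j)
    Sat-sameClass e i j = Sat-rename u (pairVar i j) pairVar-env φ
      where
      pairVar-env : ∀ k → e (pairVar i j k) ≡ env2 (e i) (e j) k
      pairVar-env zero       = refl
      pairVar-env (suc zero) = refl

    Sat-relativise : ∀ {k m} (c : ℕ) (ρ : Fin k → Fin m) (g : Fin m)
      {e : Fin m → ℕ} {e′ : Fin k → ℕ} → (∀ i → e (ρ i) ≡ e′ i) →
      (∀ y → dom u y → R y (e g) ⇔ R y c) →
      (ψ : Formula A k) → Sat u e (relativise ρ g ψ) ⇔ Sat (classWord φ u c) e′ ψ
    Sat-relativise c ρ g eq same (less i j) =
      mk⇔ (subst₂ (lt u) (eq i) (eq j)) (subst₂ (lt u) (sym (eq i)) (sym (eq j)))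
    Sat-relativise c ρ g eq same (letter a i) =
      mk⇔ (trans (cong (lab u) (sym (eq i)))) (trans (cong (lab u) (eq i)))
    Sat-relativise c ρ g eq same (neg ψ) =
      ¬-cong-⇔ (Sat-relativise c ρ g eq same ψ)
    Sat-relativise c ρ g eq same (and ψ χ) =
      Sat-relativise c ρ g eq same ψ ×-⇔ Sat-relativise c ρ g eq same χ
    Sat-relativise c ρ g {e} {e′} eq same (ex ψ) =
      mk⇔ (λ (y , dy , s , t) → y , (dy , to (in-class y dy) s) , to (IH y) t)
          (λ (y , (dy , r) , t) → y , dy , from (in-class y dy) r , from (IH y) t)
      where
      in-class : ∀ y → dom u y → Sat u (extend y e) (sameClass zero (suc g)) ⇔ R y c
      in-class y dy = same y dy ⇔-∘ Sat-sameClass (extend y e) zero (suc g)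
      IH : ∀ y → Sat u (extend y e) (relativise (lift ρ) (suc g) ψ)
                 ⇔ Sat (classWord φ u c) (extend y e′) ψ
      IH y = Sat-relativise c (lift ρ) (suc g) (extend-lift y ρ eq) same ψ

    IsFirst : ℕ → Set
    IsFirst x = ¬ Σ ℕ λ y → dom u y × lt u y x × R y x

    Sat-isFirst : ∀ {n} x (e : Fin n → ℕ) → Sat u (extend x e) isFirst ⇔ IsFirst x
    Sat-isFirst x e = ¬-cong-⇔ (Σ-⇔ (↠-id ℕ) λ {y} →
      ⇔-id _ ×-⇔ ⇔-id _ ×-⇔ Sat-sameClass (extend y (extend x e)) zero (suc zero))

    module Classes (em : ExcludedMiddle 0ℓ) (cond : IsCondensationFormula φ)
                   (ou : IsOrdinalWord u) where

      open IsOrdinalWord ou using (irrefl; tri; wf)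

      R-refl : ∀ m → dom u m → R m m
      R-refl = proj₁ (cond u ou)

      R-sym : ∀ m n → dom u m → dom u n → R m n → R n m
      R-sym = proj₁ (proj₂ (cond u ou))

      R-trans : ∀ m n k → dom u m → dom u n → dom u k → R m n → R n k → R m k
      R-trans = proj₁ (proj₂ (proj₂ (cond u ou)))

      R-convex : ∀ m n k → dom u m → dom u n → dom u k →
        lt u m n → lt u n k → R m k → R m n
      R-convex = proj₂ (proj₂ (proj₂ (cond u ou)))

      least-in-class : ∀ n → dom u n → Σ ℕ λ m → dom (condense φ u) m × R n m
      least-in-class n dn
        with minimal-element {_≺_ = _<_} {P = λ k → dom u k × R n k}
               em <-wellFounded (dn , R-refl n dn)
      ... | m , (dm , rnm) , below = m , (dm , least) , rnm
        where
        least : ∀ k → dom u k → R k m → m ≤ k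
        least k dk rkm = ≮⇒≥ λ k<m →
          below k<m (dk , R-trans n m k dn dm dk rnm (R-sym k m dk dm rkm))

      first-in-class : ∀ n → dom u n → Σ ℕ λ m → (dom u m × IsFirst m) × R m n
      first-in-class n dn
        with minimal-element {P = λ (y , _) → R y n} em wf {n , dn} (R-refl n dn)
      ... | (m , dm) , rmn , below = m , (dm , first) , rmn
        where
        first : IsFirst m
        first (y , dy , y<m , rym) = below {y , dy} y<m (R-trans y m n dy dm dn rym rmn)

      least-unique : ∀ {m n} → dom (condense φ u) m → dom (condense φ u) n →
        R m n → m ≡ n
      least-unique {m} {n} (dm , m-least) (dn , n-least) rmn =
        ≤-antisym (m-least n dn (R-sym m n dm dn rmn)) (n-least m dm rmn)

      lt-across-classes : ∀ {x y x′ y′} → dom u x → dom u y → dom u x′ → dom u y′ →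
        ¬ R x y → lt u x y → R x x′ → R y y′ → lt u x′ y′
      lt-across-classes {x} {y} {x′} {y′} dx dy dx′ dy′ ¬rxy x<y rxx′ ryy′
        with tri x′ y′ dx′ dy′
      ... | inj₁ x′<y′ = x′<y′
      ... | inj₂ (inj₁ refl) =
        ⊥-elim (¬rxy (R-trans x x′ y dx dx′ dy rxx′ (R-sym y x′ dy dx′ ryy′)))
      ... | inj₂ (inj₂ y′<x′) = ⊥-elim (¬rxy (R-trans x x′ y dx dx′ dy rxx′ rx′y))
        where
        x′<y : lt u x′ y
        x′<y with tri x′ y dx′ dy
        ... | inj₁ x′<y         = x′<y
        ... | inj₂ (inj₁ refl)  = ⊥-elim (¬rxy rxx′)
        ... | inj₂ (inj₂ y<x′)  = ⊥-elim (¬rxy (R-convex x y x′ dx dy dx′ x<y y<x′ rxx′))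
        rx′y : R x′ y
        rx′y = R-trans x′ y′ y dx′ dy′ dy
          (R-sym y′ x′ dy′ dx′
            (R-convex y′ x′ y dy′ dx′ dy y′<x′ x′<y (R-sym y y′ dy dy′ ryy′)))
          (R-sym y y′ dy dy′ ryy′)

      -- φ̂(u) indexes a class by its ℕ-least position, which is not FO-definable;
      -- the translation uses the lt-first position of the class instead.
      record Corresponding (n n′ : ℕ) : Set where
        field
          least     : dom (condense φ u) n
          first-dom : dom u n′
          first     : IsFirst n′
          related   : R n′ n

      module _ {B : Set} (f : Word A → B) (fdef : FODefinable NonEmpty f) where

        condensed : Word B
        condensed = mapWord f (condense φ u)

        private
          fs : B → Sentence A
          fs b = proj₁ (fdef b)

        classWord-isOrdinalWord : ∀ n → IsOrdinalWord (classWord φ u n)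
        classWord-isOrdinalWord n =
          restrict-isOrdinalWord u ou _ (λ _ → proj₁) (lab u)

        condensed-isOrdinalWord : IsOrdinalWord condensed
        condensed-isOrdinalWord =
          restrict-isOrdinalWord u ou _ (λ _ → proj₁) (λ n → f (classWord φ u n))

        Sat-letter : ∀ {k} (b : B) (i : Fin k) {e e′ : Fin k → ℕ} →
          Corresponding (e i) (e′ i) →
          Sat condensed e (letter b i) ⇔ Sat u e′ (translate fs (letter b i))
        Sat-letter b i {e} {e′} corr =
          ⇔-sym (Sat-relativise (e i) (λ ()) i {e′ = emptyEnv} (λ ()) same-class (fs b))
          ⇔-∘ proj₂ (fdef b) (classWord φ u (e i)) (classWord-isOrdinalWord (e i))
                (e i , di , R-refl (e i) di)
          where
          open Corresponding corr
          di = proj₁ least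
          same-class : ∀ y → dom u y → R y (e′ i) ⇔ R y (e i)
          same-class y dy =
            mk⇔ (λ r → R-trans y (e′ i) (e i) dy first-dom di r related)
                (λ r → R-trans y (e i) (e′ i) dy di first-dom r
                         (R-sym (e′ i) (e i) first-dom di related))

        Sat-less : ∀ {k} (i j : Fin k) {e e′ : Fin k → ℕ} →
          Corresponding (e i) (e′ i) → Corresponding (e j) (e′ j) →
          Sat condensed e (less i j) ⇔ Sat u e′ (less i j)
        Sat-less i j {e} {e′} ci cj = mk⇔
          (λ ei<ej → lt-across-classes (proj₁ Ci.least) (proj₁ Cj.least)
            Ci.first-dom Cj.first-dom (distinct-least ei<ej) ei<ej
            (R-sym _ _ Ci.first-dom (proj₁ Ci.least) Ci.related)
            (R-sym _ _ Cj.first-dom (proj₁ Cj.least) Cj.related))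
          (λ e′i<e′j → lt-across-classes Ci.first-dom Cj.first-dom
            (proj₁ Ci.least) (proj₁ Cj.least)
            (λ r → Cj.first (e′ i , Ci.first-dom , e′i<e′j , r)) e′i<e′j
            Ci.related Cj.related)
          where
          module Ci = Corresponding ci
          module Cj = Corresponding cj
          distinct-least : lt u (e i) (e j) → ¬ R (e i) (e j)
          distinct-least ei<ej r = irrefl (e j) (proj₁ Cj.least)
            (subst (λ z → lt u z (e j)) (least-unique Ci.least Cj.least r) ei<ej)

        Sat-translate : ∀ {k} (ψ : Formula B k) (e e′ : Fin k → ℕ) →
          (∀ i → Corresponding (e i) (e′ i)) →
          Sat condensed e ψ ⇔ Sat u e′ (translate fs ψ)
        Sat-translate (less i j)   e e′ corr = Sat-less i j {e} {e′} (corr i) (corr j)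
        Sat-translate (letter b i) e e′ corr = Sat-letter b i {e} {e′} (corr i)
        Sat-translate (neg ψ)      e e′ corr = ¬-cong-⇔ (Sat-translate ψ e e′ corr)
        Sat-translate (and ψ χ)    e e′ corr =
          Sat-translate ψ e e′ corr ×-⇔ Sat-translate χ e e′ corr
        Sat-translate (ex ψ)       e e′ corr = mk⇔
          (λ (m , least , s) →
            let (m′ , (dm′ , first) , related) = first-in-class m (proj₁ least)
                c = record { least = least ; first-dom = dm′ ; first = first ; related = related }
            in m′ , dm′ , from (Sat-isFirst m′ e′) first , to (IH c) s)
          (λ (m′ , dm′ , sf , s) →
            let (m , least , rm′m) = least-in-class m′ dm′
                c = record { least = least ; first-dom = dm′
                           ; first = to (Sat-isFirst m′ e′) sf ; related = rm′m }
            in m , least , from (IH c) s)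
          where
          IH : ∀ {m m′} → Corresponding m m′ →
            Sat condensed (extend m e) ψ ⇔ Sat u (extend m′ e′) (translate fs ψ)
          IH {m} {m′} c = Sat-translate ψ (extend m e) (extend m′ e′) λ
            { zero → c ; (suc i) → corr i }

mainTheorem7 : ExcludedMiddle 0ℓ →
    {A B C : Set} → Finite A → Finite B → Finite C →
    (φ : Formula A 2) → IsCondensationFormula φ →
    (f : Word A → B) → FODefinable NonEmpty f →
    (g : Word B → C) → FODefinable AllWords g →
    FODefinable AllWords (λ u → g (mapWord f (condense φ u)))
mainTheorem7 em _ _ _ φ cond f fdef g gdef c =
  translate (λ b → proj₁ (fdef b)) (proj₁ (gdef c)) , λ u ou _ →
    let open Classes u em cond ou
    in Sat-translate f fdef (proj₁ (gdef c)) emptyEnv emptyEnv (λ ())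
       ⇔-∘ proj₂ (gdef c) (condensed f fdef) (condensed-isOrdinalWord f fdef) tt
  where
  open Condensation φ
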